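{- Let $G$ be a $P_7$-free chordal graph. Then $\mathcal{D}_{RN}(G)$ is exactly the family of sets $A\subseteq RN(G)$ such that every $x\in A$ has a private neighbour w.r.t. $A$ in some irredundant component $C$ of $G$ with $C\subseteq N(A)$ (equivalently, $R(A)=\emptyset$).
   Context: All graphs are finite, simple and undirected. $N(x)$, $N[x]=N(x)\cup\{x\}$ are the open and closed neighbourhoods; for $X\subseteq V(G)$, $N[X]=\bigcup_{x\in X}N[x]$ and $N(X)=N[X]\setminus X$. A minimal dominating set of $G$ is an inclusion-minimal $D$ with $N[D]=V(G)$. A vertex $x$ is irredundant if $N[x]$ is inclusion-minimal in $\{N[y]:y\in V(G)\}$, with the convention that among several vertices having the same inclusion-minimal closed neighbourhood exactly one (fixed) is declared irredundant; all other vertices are redundant. $IR(G)$, $RN(G)$ are the sets of irredundant and redundant vertices; an irredundant component is the vertex set of a connected component of $G[IR(G)]$. For $D\subseteq V(G)$ and $x\in D$, a private neighbour of $x$ w.r.t. $D$ is a vertex $u$ with $N[u]\cap D=\{x\}$; $Priv_{IR}(D,x)$ is the set of such private neighbours in $IR(G)$. $\mathcal{D}_{RN}(G)=\{D\cap RN(G): D\text{ a minimal dominating set of }G\}$. For $A\subseteq RN(G)$, $B(A)$ is the set of $a\in A$ having an element of $Priv_{IR}(A,a)$ in some irredundant component $C$ with $C\subseteq N(A)$, and $R(A)=A\setminus B(A)$. $P_7$-free means no induced path on $7$ vertices; chordal means no induced cycle of length at least four. -}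

module Defs where

open import Data.Bool using (Bool; true; false; _∨_)
open import Data.Nat using (ℕ; suc; _≤_; _∸_)
open import Data.Fin using (Fin; toℕ)
open import Data.Fin.Subset using (Subset; _∈_; _∉_; _⊆_; _∩_; ∁; ⁅_⁆)
open import Data.Vec using (tabulate)
open import Data.Product using (Σ; ∃; ∃-syntax; _×_)
open import Data.Sum using (_⊎_)
open import Relation.Nullary using (¬_)
open import Relation.Nullary.Decidable using (⌊_⌋)
open import Relation.Binary.PropositionalEquality using (_≡_)
open import Relation.Binary.Construct.Closure.ReflexiveTransitive using (Star)
open import Function.Definitions using (Injective)
import Data.Fin as F

record Graph (n : ℕ) : Set where
  field
    adj     : Fin n → Fin n → Bool
    sym     : ∀ x y → adj x y ≡ adj y x
    irrefl  : ∀ x → adj x x ≡ false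
open Graph public

module _ {n : ℕ} (G : Graph n) where

  N[_] : Fin n → Subset n
  N[ x ] = tabulate (λ y → ⌊ x F.≟ y ⌋ ∨ adj G x y)

  InOpenNbhd : Subset n → Fin n → Set
  InOpenNbhd A v = v ∉ A × ∃[ x ] (x ∈ A × v ∈ N[ x ])

  Dominating : Subset n → Set
  Dominating D = ∀ v → ∃[ x ] (x ∈ D × v ∈ N[ x ])

  MinimalDominating : Subset n → Set
  MinimalDominating D = Dominating D × (∀ D′ → D′ ⊆ D → Dominating D′ → D ⊆ D′)

  MinimalNbhd : Fin n → Set
  MinimalNbhd x = ∀ y → N[ y ] ⊆ N[ x ] → N[ x ] ⊆ N[ y ]

  -- I is an admissible choice of the set IR(G) of irredundant vertices:
  -- every vertex of I has minimal closed neighbourhood, and each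
  -- minimal closed neighbourhood is realised by exactly one vertex of I.
  IRChoice : Subset n → Set
  IRChoice I =
      (∀ x → x ∈ I → MinimalNbhd x)
    × (∀ x → MinimalNbhd x → ∃[ y ] (y ∈ I × N[ y ] ≡ N[ x ]))
    × (∀ y z → y ∈ I → z ∈ I → N[ y ] ≡ N[ z ] → y ≡ z)

  PrivateNbr : Subset n → Fin n → Fin n → Set
  PrivateNbr D x u = N[ u ] ∩ D ≡ ⁅ x ⁆

  EdgeIn : Subset n → Fin n → Fin n → Set
  EdgeIn I u v = u ∈ I × v ∈ I × adj G u v ≡ true

  IrrComponent : Subset n → Subset n → Set
  IrrComponent I C = Σ (Fin n) λ c → c ∈ I × c ∈ C ×
    (∀ v → (v ∈ C → v ∈ I × Star (EdgeIn I) c v)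
         × (v ∈ I → Star (EdgeIn I) c v → v ∈ C))

  -- 𝒟_RN(G) membership, with RN(G) = ∁ I
  InDRN : Subset n → Subset n → Set
  InDRN I A = ∃[ D ] (MinimalDominating D × D ∩ ∁ I ≡ A)

  GoodSet : Subset n → Subset n → Set
  GoodSet I A = ∀ x → x ∈ A → ∃[ u ] ∃[ C ]
    (u ∈ I × PrivateNbr A x u × IrrComponent I C × u ∈ C
      × (∀ v → v ∈ C → InOpenNbhd A v))

  InducedPath : (k : ℕ) → (Fin k → Fin n) → Set
  InducedPath k f = Injective _≡_ _≡_ f ×
    (∀ i j → adj G (f i) (f j) ≡ true →
        (toℕ j ≡ suc (toℕ i) ⊎ toℕ i ≡ suc (toℕ j))) ×
    (∀ i j → (toℕ j ≡ suc (toℕ i) ⊎ toℕ i ≡ suc (toℕ j)) →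
        adj G (f i) (f j) ≡ true)

  P7Free : Set
  P7Free = ¬ (Σ (Fin 7 → Fin n) (InducedPath 7))

  CycAdj : (k : ℕ) → Fin k → Fin k → Set
  CycAdj k i j = toℕ j ≡ suc (toℕ i) ⊎ toℕ i ≡ suc (toℕ j)
               ⊎ (toℕ i ≡ 0 × toℕ j ≡ k ∸ 1) ⊎ (toℕ j ≡ 0 × toℕ i ≡ k ∸ 1)

  InducedCycle : (k : ℕ) → (Fin k → Fin n) → Set
  InducedCycle k f = Injective _≡_ _≡_ f ×
    (∀ i j → adj G (f i) (f j) ≡ true → CycAdj k i j) ×
    (∀ i j → CycAdj k i j → adj G (f i) (f j) ≡ true)

  Chordal : Set
  Chordal = ∀ k → 4 ≤ k → ¬ (Σ (Fin k → Fin n) (InducedCycle k))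

module Submission where

open import Defs
open import Data.Nat using (ℕ)
open import Data.Fin.Subset using (Subset; _⊆_; ∁)
open import Data.Product using (_×_)
open import Function.Bundles using (_⇔_)

-- The heart of the argument is structural: in a P₇-free chordal graph the
-- vertices with inclusion-minimal closed neighbourhoods induce no P₃, so every
-- irredundant component is a clique, equal to N[w] ∩ IR(G) for any w in it.
-- Indeed, if a - b - c were an induced P₃ of such vertices, minimality lets us
-- push away from b twice at each end, producing a chain a₂ a₁ a b c c₁ c₂ in
-- which every three consecutive vertices form an induced P₃.  Chordality kills
-- every chord of such a chain (a chord would close an induced C₄, C₅, C₆ or C₇),
-- so the chain is an induced P₇.
--
-- With the clique structure at hand both directions are direct:
-- a minimal dominating set D gives every x ∈ D \ IR(G) a private neighbour,
-- which can be pushed down to an irredundant one w; then N[w] ∩ IR(G) is the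
-- required component.  Conversely, for a good set A we add the irredundant
-- vertices not dominated by A and prune greedily, never removing A; the good
-- property makes each vertex of A irremovable, so the result is minimal.

open import Data.Bool using (Bool; true; false; T)
import Data.Bool as Bool
open import Data.Bool.Properties using (T-≡; T-∨)
open import Data.Nat using (zero; suc; _∸_; _≤?_)
import Data.Nat as ℕ
open import Data.Fin using (Fin; toℕ; zero; suc) renaming (_≟_ to _≟ᶠ_)
open import Data.Fin.Patterns using (0F; 1F; 2F; 3F)
open import Data.Fin.Properties using (all?; any?; ¬∀⟶∃¬)
open import Data.Fin.Subset using (_∈_; _∉_; _∩_; _∪_; _-_; _⊂_; ⁅_⁆)
open import Data.Fin.Subset.Properties
  using (_∈?_; _⊆?_; ⊆-antisym; x∈p∩q⁺; x∈p∩q⁻; p∩q⊆p; x∈p∪q⁺; x∈p∪q⁻;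
         x∈⁅x⁆; x∈⁅y⁆⇒x≡y; x∈p∧x≢y⇒x∈p-y; p─q⊆p; x∈p⇒x∉∁p; x∈∁p⇒x∉p; x∉p⇒x∈∁p)
open import Data.Fin.Subset.Induction using (⊂-wellFounded)
open import Data.Vec using (Vec; []; _∷_; tabulate; lookup; here; there)
open import Data.Vec.Properties using ([]=⇒lookup; lookup⇒[]=; lookup∘tabulate)
open import Data.List using (List; []; _∷_; _++_; map; allFin)
open import Data.List.Membership.Propositional using () renaming (_∈_ to _∈ˡ_)
open import Data.List.Membership.Propositional.Properties using (∈-map⁺; ∈-++⁺ˡ; ∈-++⁺ʳ; ∈-allFin)
open import Data.List.Relation.Unary.Any using (here; there)
open import Data.List.Relation.Unary.All using (All; []; _∷_)
import Data.List.Relation.Unary.All as All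
open import Data.Product using (∃₂; ∃-syntax; _,_; proj₁; proj₂; uncurry)
import Data.Product as Product
open import Data.Sum using (_⊎_; inj₁; inj₂; [_,_]′)
open import Data.Empty using (⊥; ⊥-elim)
open import Relation.Nullary using (¬_; Dec; yes; no)
open import Relation.Nullary.Decidable
  using (⌊_⌋; True; toWitness; fromWitness; _×-dec_; _⊎-dec_; _→-dec_; ¬?)
open import Relation.Binary.PropositionalEquality
  using (_≡_; _≢_; refl; trans; cong; subst; ≢-sym; module ≡-Reasoning)
  renaming (sym to ≡-sym)
open import Relation.Binary.Construct.Closure.ReflexiveTransitive using (Star; ε; _◅_; _◅◅_)
import Relation.Binary.Construct.On as On
open import Induction.WellFounded using (Acc; acc)
open import Function.Bundles using (Equivalence; mk⇔)
open import Function.Definitions using (Injective)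

∈-tabulate⁻ : ∀ {n} {f : Fin n → Bool} {v} → v ∈ tabulate f → T (f v)
∈-tabulate⁻ {f = f} {v} v∈ =
  Equivalence.from T-≡ (trans (≡-sym (lookup∘tabulate f v)) ([]=⇒lookup v∈))

∈-tabulate⁺ : ∀ {n} {f : Fin n → Bool} {v} → T (f v) → v ∈ tabulate f
∈-tabulate⁺ {f = f} {v} t =
  lookup⇒[]= v (tabulate f) (trans (lookup∘tabulate f v) (Equivalence.to T-≡ t))

subsetOf : ∀ {n} {P : Fin n → Set} → (∀ v → Dec (P v)) → Subset n
subsetOf P? = tabulate (λ v → ⌊ P? v ⌋)

∈-subsetOf⁻ : ∀ {n} {P : Fin n → Set} (P? : ∀ v → Dec (P v)) {v} → v ∈ subsetOf P? → P v
∈-subsetOf⁻ P? v∈ = toWitness (∈-tabulate⁻ v∈)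

∈-subsetOf⁺ : ∀ {n} {P : Fin n → Set} (P? : ∀ v → Dec (P v)) {v} → P v → v ∈ subsetOf P?
∈-subsetOf⁺ P? p = ∈-tabulate⁺ (fromWitness p)

x∉p-x : ∀ {n} (p : Subset n) (x : Fin n) → x ∉ p - x
x∉p-x (_ ∷ p) zero    ()
x∉p-x (_ ∷ p) (suc x) (there x∈) = x∉p-x p x x∈

x∈p-y⁻ : ∀ {n} {p : Subset n} {x y} → x ∈ p - y → x ∈ p × x ≢ y
x∈p-y⁻ {p = p} {y = y} x∈ =
  p─q⊆p p ⁅ y ⁆ x∈ , λ { refl → x∉p-x p y x∈ }

-mono : ∀ {n} {p q : Subset n} {y} → p ⊆ q → p - y ⊆ q - y
-mono p⊆q x∈ = let x∈p , x≢y = x∈p-y⁻ x∈ in x∈p∧x≢y⇒x∈p-y (p⊆q x∈p) x≢y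

⊈⇒∃ : ∀ {n} {p q : Subset n} → ¬ (p ⊆ q) → ∃[ v ] (v ∈ p × v ∉ q)
⊈⇒∃ {n} {p} {q} p⊈q
  with ¬∀⟶∃¬ n (λ v → v ∈ p → v ∈ q) (λ v → (v ∈? p) →-dec (v ∈? q)) (λ h → p⊈q (h _))
... | v , ¬[v∈p⇒v∈q] with v ∈? p
...   | yes v∈p = v , v∈p , λ v∈q → ¬[v∈p⇒v∈q] (λ _ → v∈q)
...   | no  v∉p = ⊥-elim (¬[v∈p⇒v∈q] (λ v∈p → ⊥-elim (v∉p v∈p)))

pairs : ∀ k → List (Fin k × Fin k)
pairs zero    = []
pairs (suc k) = map (λ j → zero , suc j) (allFin k) ++ map (Product.map suc suc) (pairs k)

pairs-shift : ∀ {k} {i j : Fin k} → (i , j) ∈ˡ pairs k → (suc i , suc j) ∈ˡ pairs (suc k)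
pairs-shift {k} ij∈ = ∈-++⁺ʳ (map (λ j → zero , suc j) (allFin k)) (∈-map⁺ (Product.map suc suc) ij∈)

pairs-cover : ∀ {k} (i j : Fin k) → i ≡ j ⊎ (i , j) ∈ˡ pairs k ⊎ (j , i) ∈ˡ pairs k
pairs-cover zero    zero    = inj₁ refl
pairs-cover zero    (suc j) = inj₂ (inj₁ (∈-++⁺ˡ (∈-map⁺ _ (∈-allFin j))))
pairs-cover (suc i) zero    = inj₂ (inj₂ (∈-++⁺ˡ (∈-map⁺ _ (∈-allFin i))))
pairs-cover (suc i) (suc j) with pairs-cover i j
... | inj₁ refl         = inj₁ refl
... | inj₂ (inj₁ ij∈)   = inj₂ (inj₁ (pairs-shift ij∈))
... | inj₂ (inj₂ ji∈)   = inj₂ (inj₂ (pairs-shift ji∈))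

Pattern : ℕ → Set
Pattern k = Fin k → Fin k → Bool

SymmetricPattern : ∀ {k} → Pattern k → Set
SymmetricPattern s = ∀ i j → s i j ≡ s j i

LoopFree : ∀ {k} → Pattern k → Set
LoopFree s = ∀ i → s i i ≡ false

-- Distinct positions are adjacent or have different neighbours in the pattern,
-- so a realisation of the pattern is automatically injective.
Separating : ∀ {k} → Pattern k → Set
Separating s = ∀ i j → i ≡ j ⊎ s i j ≡ true ⊎ ∃[ m ] (s i m ≢ s j m)

symmetric? : ∀ {k} (s : Pattern k) → Dec (SymmetricPattern s)
symmetric? s = all? λ i → all? λ j → s i j Bool.≟ s j i

loopFree? : ∀ {k} (s : Pattern k) → Dec (LoopFree s)
loopFree? s = all? λ i → s i i Bool.≟ false

separating? : ∀ {k} (s : Pattern k) → Dec (Separating s)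
separating? s = all? λ i → all? λ j →
  (i ≟ᶠ j) ⊎-dec ((s i j Bool.≟ true) ⊎-dec any? (λ m → ¬? (s i m Bool.≟ s j m)))

module Neighbourhood {n : ℕ} (G : Graph n) where

  infix 4 _~_ _≁_

  _~_ : Fin n → Fin n → Set
  x ~ y = adj G x y ≡ true

  _≁_ : Fin n → Fin n → Set
  x ≁ y = adj G x y ≡ false

  adj-sym : ∀ {x y b} → adj G x y ≡ b → adj G y x ≡ b
  adj-sym {x} {y} e = trans (Graph.sym G y x) e

  edgeOrNot : ∀ x y → x ~ y ⊎ x ≁ y
  edgeOrNot x y with adj G x y
  ... | true  = inj₁ refl
  ... | false = inj₂ refl

  refuteEdge : ∀ {x y} → ¬ (x ~ y) → x ≁ y
  refuteEdge {x} {y} ¬xy = [ (λ xy → ⊥-elim (¬xy xy)) , (λ x≁y → x≁y) ]′ (edgeOrNot x y)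

  edge-nonedge : ∀ {x y} → x ~ y → x ≁ y → ⊥
  edge-nonedge xy x≁y with trans (≡-sym xy) x≁y
  ... | ()

  ~⇒≢ : ∀ {x y} → x ~ y → x ≢ y
  ~⇒≢ {x} xy refl = edge-nonedge xy (irrefl G x)

  N : Fin n → Subset n
  N x = N[_] G x

  ∈N⁻ : ∀ {x v} → v ∈ N x → x ≡ v ⊎ x ~ v
  ∈N⁻ v∈ = Data.Sum.map toWitness (Equivalence.to T-≡) (Equivalence.to T-∨ (∈-tabulate⁻ v∈))

  ∈N⁺ : ∀ {x v} → x ≡ v ⊎ x ~ v → v ∈ N x
  ∈N⁺ h = ∈-tabulate⁺ (Equivalence.from T-∨ (Data.Sum.map fromWitness (Equivalence.from T-≡) h))

  N-refl : ∀ x → x ∈ N x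
  N-refl x = ∈N⁺ (inj₁ refl)

  N-sym : ∀ {x v} → v ∈ N x → x ∈ N v
  N-sym v∈ = ∈N⁺ (Data.Sum.map ≡-sym adj-sym (∈N⁻ v∈))

  ~⇒∈N : ∀ {x v} → x ~ v → v ∈ N x
  ~⇒∈N xv = ∈N⁺ (inj₂ xv)

  ∈N⇒~ : ∀ {x v} → v ∈ N x → x ≢ v → x ~ v
  ∈N⇒~ v∈ x≢v = [ (λ x≡v → ⊥-elim (x≢v x≡v)) , (λ xv → xv) ]′ (∈N⁻ v∈)

  ∉N⇒≁ : ∀ {x v} → v ∉ N x → x ≁ v
  ∉N⇒≁ v∉ = refuteEdge (λ xv → v∉ (~⇒∈N xv))

  ≁⇒∉N : ∀ {x v} → x ≢ v → x ≁ v → v ∉ N x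
  ≁⇒∉N x≢v x≁v v∈ = edge-nonedge (∈N⇒~ v∈ x≢v) x≁v

  ∈∉⇒≢ : ∀ {p : Subset n} {u v} → u ∈ p → v ∉ p → u ≢ v
  ∈∉⇒≢ u∈ v∉ refl = v∉ u∈

  notBelow? : ∀ u y → Dec (N y ⊆ N u → N u ⊆ N y)
  notBelow? u y = (N y ⊆? N u) →-dec (N u ⊆? N y)

  -- Every closed neighbourhood contains an inclusion-minimal one: descend
  -- along strict inclusion of closed neighbourhoods, which is well founded.
  minimalBelow : ∀ u → ∃[ x ] (MinimalNbhd G x × N x ⊆ N u)
  minimalBelow u = descend u (On.wellFounded N ⊂-wellFounded u)
    where
    descend : ∀ u → Acc (λ y x → N y ⊂ N x) u → ∃[ x ] (MinimalNbhd G x × N x ⊆ N u)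
    descend u (acc smaller) with all? (notBelow? u)
    ... | yes minimal = u , minimal , (λ v∈ → v∈)
    ... | no ¬minimal with ¬∀⟶∃¬ n _ (notBelow? u) ¬minimal
    ...   | y , y-below with N y ⊆? N u
    ...     | no  Ny⊈Nu = ⊥-elim (y-below (λ Ny⊆Nu → ⊥-elim (Ny⊈Nu Ny⊆Nu)))
    ...     | yes Ny⊆Nu =
      let x , mx , Nx⊆Ny = descend y (smaller (Ny⊆Nu , ⊈⇒∃ (λ Nu⊆Ny → y-below (λ _ → Nu⊆Ny))))
      in x , mx , (λ v∈ → Ny⊆Nu (Nx⊆Ny v∈))

  record P3 (a b c : Fin n) : Set where
    constructor p3
    field
      edge₁    : a ~ b
      edge₂    : b ~ c
      distinct : a ≢ c
      nonedge  : a ≁ c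

  P3-reverse : ∀ {a b c} → P3 a b c → P3 c b a
  P3-reverse (p3 ab bc a≢c a≁c) = p3 (adj-sym bc) (adj-sym ab) (≢-sym a≢c) (adj-sym a≁c)

  P3-escape : ∀ {a b c} → P3 a b c → c ∈ N b × c ∉ N a
  P3-escape (p3 _ bc a≢c a≁c) = ~⇒∈N bc , ≁⇒∉N a≢c a≁c

  escape : ∀ {x y z} → MinimalNbhd G y → z ∈ N y → z ∉ N x → ∃[ w ] (w ∈ N x × w ∉ N y)
  escape {x} my z∈Ny z∉Nx = ⊈⇒∃ (λ Nx⊆Ny → z∉Nx (my x Nx⊆Ny z∈Ny))

  pushAway : ∀ {x y z} → MinimalNbhd G y → x ~ y → z ∈ N y → z ∉ N x → ∃[ w ] P3 w x y
  pushAway {x} {y} my xy z∈Ny z∉Nx =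
    let w , w∈Nx , w∉Ny = escape my z∈Ny z∉Nx
        x≢w = ∈∉⇒≢ (~⇒∈N (adj-sym xy)) w∉Ny
    in w , p3 (adj-sym (∈N⇒~ w∈Nx x≢w)) xy (≢-sym (∈∉⇒≢ (N-refl y) w∉Ny)) (adj-sym (∉N⇒≁ w∉Ny))

  extendBeyond : ∀ {x y z} → MinimalNbhd G x → MinimalNbhd G y → P3 x y z →
                 ∃₂ λ x₂ x₁ → P3 x₂ x₁ x × P3 x₁ x y
  extendBeyond mx my xyz =
    let x₁ , x₁xy  = uncurry (pushAway my (P3.edge₁ xyz)) (P3-escape xyz)
        x₂ , x₂x₁x = uncurry (pushAway mx (P3.edge₁ x₁xy)) (P3-escape x₁xy)
    in x₂ , x₁ , x₂x₁x , x₁xy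

module Obstructions {n : ℕ} (G : Graph n) where
  open Neighbourhood G

  Realises : (k : ℕ) → Pattern k → (Fin k → Fin n) → Set
  Realises k s f = ∀ i j → adj G (f i) (f j) ≡ s i j

  PairFacts : (k : ℕ) → Pattern k → (Fin k → Fin n) → Set
  PairFacts k s f = All (λ (ij : Fin k × Fin k) → adj G (f (proj₁ ij)) (f (proj₂ ij)) ≡ s (proj₁ ij) (proj₂ ij)) (pairs k)

  realises : ∀ {k} {s : Pattern k} {f} → SymmetricPattern s → LoopFree s → PairFacts k s f → Realises k s f
  realises {f = f} s-sym s-loop facts i j with pairs-cover i j
  ... | inj₁ refl       = trans (irrefl G (f i)) (≡-sym (s-loop i))
  ... | inj₂ (inj₁ ij∈) = All.lookup facts ij∈
  ... | inj₂ (inj₂ ji∈) = trans (adj-sym (All.lookup facts ji∈)) (s-sym j i)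

  realises-injective : ∀ {k} {s : Pattern k} {f} → Separating s → Realises k s f → Injective _≡_ _≡_ f
  realises-injective {s = s} {f} separating R {i} {j} fi≡fj with separating i j
  ... | inj₁ i≡j              = i≡j
  ... | inj₂ (inj₁ sij)       = ⊥-elim (~⇒≢ (trans (R i j) sij) fi≡fj)
  ... | inj₂ (inj₂ (m , s≢)) = ⊥-elim (s≢ (begin
      s i m           ≡⟨ ≡-sym (R i m) ⟩
      adj G (f i) (f m) ≡⟨ cong (λ x → adj G x (f m)) fi≡fj ⟩
      adj G (f j) (f m) ≡⟨ R j m ⟩
      s j m           ∎))
    where open ≡-Reasoning

  inducedBy : ∀ {k} {Rel : Fin k → Fin k → Set} (Rel? : ∀ i j → Dec (Rel i j)) {f} →
              Realises k (λ i j → ⌊ Rel? i j ⌋) f →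
              (∀ i j → f i ~ f j → Rel i j) × (∀ i j → Rel i j → f i ~ f j)
  inducedBy Rel? R =
      (λ i j fifj → toWitness (Equivalence.from T-≡ (trans (≡-sym (R i j)) fifj)))
    , (λ i j r → trans (R i j) (Equivalence.to T-≡ (fromWitness r)))

  cycAdj? : ∀ k (i j : Fin k) → Dec (CycAdj G k i j)
  cycAdj? k i j =
    (toℕ j ℕ.≟ suc (toℕ i)) ⊎-dec ((toℕ i ℕ.≟ suc (toℕ j)) ⊎-dec
    (((toℕ i ℕ.≟ 0) ×-dec (toℕ j ℕ.≟ k ∸ 1)) ⊎-dec ((toℕ j ℕ.≟ 0) ×-dec (toℕ i ℕ.≟ k ∸ 1))))

  pathAdj? : ∀ k (i j : Fin k) → Dec (toℕ j ≡ suc (toℕ i) ⊎ toℕ i ≡ suc (toℕ j))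
  pathAdj? k i j = (toℕ j ℕ.≟ suc (toℕ i)) ⊎-dec (toℕ i ℕ.≟ suc (toℕ j))

  cycle : (k : ℕ) → Pattern k
  cycle k i j = ⌊ cycAdj? k i j ⌋

  path : (k : ℕ) → Pattern k
  path k i j = ⌊ pathAdj? k i j ⌋

  -- For concrete k the side conditions are closed decidable
  -- facts, so their proofs are trivial and are written '_' at use sites.
  noListedCycle : Chordal G → ∀ k → True (4 ≤? k) →
    True (symmetric? (cycle k)) → True (loopFree? (cycle k)) → True (separating? (cycle k)) →
    (vs : Vec (Fin n) k) → PairFacts k (cycle k) (lookup vs) → ⊥
  noListedCycle chordal k 4≤k s-sym s-loop s-sep vs facts =
    chordal k (toWitness 4≤k) (lookup vs , realises-injective (toWitness s-sep) R , inducedBy (cycAdj? k) R)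
    where
    R = realises (toWitness s-sym) (toWitness s-loop) facts

  noListedP7 : P7Free G → (vs : Vec (Fin n) 7) → PairFacts 7 (path 7) (lookup vs) → ⊥
  noListedP7 p7free vs facts =
    p7free (lookup vs , realises-injective (toWitness {a? = separating? (path 7)} _) R , inducedBy (pathAdj? 7) R)
    where
    R = realises (toWitness {a? = symmetric? (path 7)} _) (toWitness {a? = loopFree? (path 7)} _) facts

  -- The 4-cycle pattern does not separate opposite vertices, so their
  -- distinctness is an extra hypothesis.
  noListedC4 : Chordal G → ∀ {a b c d} → a ≢ c → b ≢ d →
    PairFacts 4 (cycle 4) (lookup (a ∷ b ∷ c ∷ d ∷ [])) → ⊥
  noListedC4 chordal {a} {b} {c} {d} a≢c b≢d facts =
    chordal 4 (toWitness {a? = 4 ≤? 4} _) (f , injective , inducedBy (cycAdj? 4) R)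
    where
    f = lookup (a ∷ b ∷ c ∷ d ∷ [])
    R = realises {s = cycle 4} (toWitness {a? = symmetric? (cycle 4)} _) (toWitness {a? = loopFree? (cycle 4)} _) facts
    neighbours : ∀ i j → cycle 4 i j ≡ true → f i ≢ f j
    neighbours i j e = ~⇒≢ (trans (R i j) e)
    injective : Injective _≡_ _≡_ f
    injective {0F} {0F} _ = refl
    injective {0F} {1F} e = ⊥-elim (neighbours 0F 1F refl e)
    injective {0F} {2F} e = ⊥-elim (a≢c e)
    injective {0F} {3F} e = ⊥-elim (neighbours 0F 3F refl e)
    injective {1F} {0F} e = ⊥-elim (neighbours 1F 0F refl e)
    injective {1F} {1F} _ = refl
    injective {1F} {2F} e = ⊥-elim (neighbours 1F 2F refl e)
    injective {1F} {3F} e = ⊥-elim (b≢d e)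
    injective {2F} {0F} e = ⊥-elim (a≢c (≡-sym e))
    injective {2F} {1F} e = ⊥-elim (neighbours 2F 1F refl e)
    injective {2F} {2F} _ = refl
    injective {2F} {3F} e = ⊥-elim (neighbours 2F 3F refl e)
    injective {3F} {0F} e = ⊥-elim (neighbours 3F 0F refl e)
    injective {3F} {1F} e = ⊥-elim (b≢d (≡-sym e))
    injective {3F} {2F} e = ⊥-elim (neighbours 3F 2F refl e)
    injective {3F} {3F} _ = refl

-- In a chordal graph, a chain of vertices in which every three consecutive
-- ones form an induced P₃ has no chords: a shortest chord would close an
-- induced cycle of length at least four.  Chains of 7 vertices are therefore
-- induced P₇'s (or close an induced C₇), impossible in a P₇-free chordal graph.
module ChordlessChains {n : ℕ} (G : Graph n) (chordal : Chordal G) where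
  open Neighbourhood G
  open Obstructions G

  -- Adjacency facts are listed for the pairs i < j in lexicographic order.
  noChord₄ : ∀ {a b c d} → P3 a b c → P3 b c d → a ≁ d
  noChord₄ (p3 ab bc a≢c a≁c) (p3 _ cd b≢d b≁d) =
    refuteEdge λ ad → noListedC4 chordal a≢c b≢d (ab ∷ a≁c ∷ ad ∷ bc ∷ b≁d ∷ cd ∷ [])

  noChord₅ : ∀ {a b c d e} → P3 a b c → P3 b c d → P3 c d e → a ≁ e
  noChord₅ {a} {b} {c} {d} {e} abc@(p3 ab bc _ a≁c) bcd@(p3 _ cd _ b≁d) cde@(p3 _ de _ c≁e) =
    refuteEdge λ ae → noListedCycle chordal 5 _ _ _ _ (a ∷ b ∷ c ∷ d ∷ e ∷ [])
      ( ab ∷ a≁c ∷ noChord₄ abc bcd ∷ ae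
      ∷ bc ∷ b≁d ∷ noChord₄ bcd cde
      ∷ cd ∷ c≁e
      ∷ de ∷ [])

  noChord₆ : ∀ {a b c d e f} → P3 a b c → P3 b c d → P3 c d e → P3 d e f → a ≁ f
  noChord₆ {a} {b} {c} {d} {e} {f}
           abc@(p3 ab bc _ a≁c) bcd@(p3 _ cd _ b≁d) cde@(p3 _ de _ c≁e) def@(p3 _ ef _ d≁f) =
    refuteEdge λ af → noListedCycle chordal 6 _ _ _ _ (a ∷ b ∷ c ∷ d ∷ e ∷ f ∷ [])
      ( ab ∷ a≁c ∷ noChord₄ abc bcd ∷ noChord₅ abc bcd cde ∷ af
      ∷ bc ∷ b≁d ∷ noChord₄ bcd cde ∷ noChord₅ bcd cde def
      ∷ cd ∷ c≁e ∷ noChord₄ cde def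
      ∷ de ∷ d≁f
      ∷ ef ∷ [])

  -- The ends of a seven-vertex chain are adjacent (an induced C₇) or not (an
  -- induced P₇).
  noSevenChain : P7Free G → ∀ {a b c d e f g} →
                 P3 a b c → P3 b c d → P3 c d e → P3 d e f → P3 e f g → ⊥
  noSevenChain p7free {a} {b} {c} {d} {e} {f} {g}
               abc@(p3 ab bc _ a≁c) bcd@(p3 _ cd _ b≁d) cde@(p3 _ de _ c≁e)
               def@(p3 _ ef _ d≁f) efg@(p3 _ fg _ e≁g) with edgeOrNot a g
  ... | inj₁ ag = noListedCycle chordal 7 _ _ _ _ (a ∷ b ∷ c ∷ d ∷ e ∷ f ∷ g ∷ [])
      ( ab ∷ a≁c ∷ noChord₄ abc bcd ∷ noChord₅ abc bcd cde ∷ noChord₆ abc bcd cde def ∷ ag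
      ∷ bc ∷ b≁d ∷ noChord₄ bcd cde ∷ noChord₅ bcd cde def ∷ noChord₆ bcd cde def efg
      ∷ cd ∷ c≁e ∷ noChord₄ cde def ∷ noChord₅ cde def efg
      ∷ de ∷ d≁f ∷ noChord₄ def efg
      ∷ ef ∷ e≁g
      ∷ fg ∷ [])
  ... | inj₂ a≁g = noListedP7 p7free (a ∷ b ∷ c ∷ d ∷ e ∷ f ∷ g ∷ [])
      ( ab ∷ a≁c ∷ noChord₄ abc bcd ∷ noChord₅ abc bcd cde ∷ noChord₆ abc bcd cde def ∷ a≁g
      ∷ bc ∷ b≁d ∷ noChord₄ bcd cde ∷ noChord₅ bcd cde def ∷ noChord₆ bcd cde def efg
      ∷ cd ∷ c≁e ∷ noChord₄ cde def ∷ noChord₅ cde def efg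
      ∷ de ∷ d≁f ∷ noChord₄ def efg
      ∷ ef ∷ e≁g
      ∷ fg ∷ [])

  -- Key lemma: vertices with minimal closed neighbourhoods induce no P₃.
  -- Pushing away from b at both ends of a - b - c yields a seven-vertex chain.
  noMinimalP3 : P7Free G → ∀ {a b c} →
                MinimalNbhd G a → MinimalNbhd G b → MinimalNbhd G c → ¬ P3 a b c
  noMinimalP3 p7free ma mb mc abc =
    let a₂ , a₁ , a₂a₁a , a₁ab = extendBeyond ma mb abc
        c₂ , c₁ , c₂c₁c , c₁cb = extendBeyond mc mb (P3-reverse abc)
    in noSevenChain p7free a₂a₁a a₁ab abc (P3-reverse c₁cb) (P3-reverse c₂c₁c)

  minimal-N-trans : P7Free G → ∀ {a b c} →
    MinimalNbhd G a → MinimalNbhd G b → MinimalNbhd G c → b ∈ N a → c ∈ N b → c ∈ N a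
  minimal-N-trans p7free {a} {b} {c} ma mb mc b∈Na c∈Nb with ∈N⁻ b∈Na | ∈N⁻ c∈Nb
  ... | inj₁ refl | _         = c∈Nb
  ... | inj₂ _    | inj₁ refl = b∈Na
  ... | inj₂ ab   | inj₂ bc with a ≟ᶠ c
  ...   | yes refl = N-refl a
  ...   | no  a≢c  = [ ~⇒∈N , (λ a≁c → ⊥-elim (noMinimalP3 p7free ma mb mc (p3 ab bc a≢c a≁c))) ]′
                       (edgeOrNot a c)

module Domination {n : ℕ} (G : Graph n) where
  open Neighbourhood G

  Dominates : Subset n → Fin n → Set
  Dominates D v = ∃[ x ] (x ∈ D × v ∈ N x)

  dominates? : ∀ D v → Dec (Dominates D v)
  dominates? D v = any? λ x → (x ∈? D) ×-dec (v ∈? N x)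

  dominating? : ∀ D → Dec (Dominating G D)
  dominating? D = all? (dominates? D)

  dominating-mono : ∀ {D D′} → D ⊆ D′ → Dominating G D → Dominating G D′
  dominating-mono D⊆D′ dom v = let x , x∈D , v∈Nx = dom v in x , D⊆D′ x∈D , v∈Nx

  PrivateTo : Subset n → Fin n → Fin n → Set
  PrivateTo D x u = ∀ y → y ∈ D → u ∈ N y → y ≡ x

  -- In a minimal dominating set every vertex has a private vertex: otherwise
  -- it could be removed.
  privateVertex : ∀ {D x} → MinimalDominating G D → x ∈ D → ∃[ u ] PrivateTo D x u
  privateVertex {D} {x} (_ , minimal) x∈D =
    let u , ¬dom = ¬∀⟶∃¬ n _ (dominates? (D - x)) not-dominating
    in u , λ y y∈D u∈Ny → decided y y∈D u∈Ny ¬dom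
    where
    not-dominating : ¬ Dominating G (D - x)
    not-dominating dom = x∉p-x D x (minimal (D - x) (p─q⊆p D ⁅ x ⁆) dom x∈D)
    decided : ∀ {u} y → y ∈ D → u ∈ N y → ¬ Dominates (D - x) u → y ≡ x
    decided y y∈D u∈Ny ¬dom with y ≟ᶠ x
    ... | yes y≡x = y≡x
    ... | no  y≢x = ⊥-elim (¬dom (y , x∈p∧x≢y⇒x∈p-y y∈D y≢x , u∈Ny))

  privateVertex⇒PrivateNbr : ∀ {A D x u} → A ⊆ D → PrivateTo D x u → x ∈ N u → x ∈ A → PrivateNbr G A x u
  privateVertex⇒PrivateNbr {x = x} A⊆D x-only x∈Nu x∈A = ⊆-antisym ⊆⁅x⁆ ⁅x⁆⊆
    where
    ⊆⁅x⁆ : N _ ∩ _ ⊆ ⁅ x ⁆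
    ⊆⁅x⁆ z∈ = let z∈Nu , z∈A = x∈p∩q⁻ _ _ z∈
                in subst (_∈ ⁅ x ⁆) (≡-sym (x-only _ (A⊆D z∈A) (N-sym z∈Nu))) (x∈⁅x⁆ x)
    ⁅x⁆⊆ : ⁅ x ⁆ ⊆ N _ ∩ _
    ⁅x⁆⊆ z∈ = subst (_∈ N _ ∩ _) (≡-sym (x∈⁅y⁆⇒x≡y x z∈)) (x∈p∩q⁺ (x∈Nu , x∈A))

  irremovable⇒minimal : ∀ {R} → Dominating G R → (∀ z → z ∈ R → ¬ Dominating G (R - z)) →
                        MinimalDominating G R
  irremovable⇒minimal {R} dom irremovable = dom , minimal
    where
    minimal : ∀ D′ → D′ ⊆ R → Dominating G D′ → R ⊆ D′
    minimal D′ D′⊆R domD′ {z} z∈R with z ∈? D′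
    ... | yes z∈D′ = z∈D′
    ... | no  z∉D′ = ⊥-elim (irremovable z z∈R (dominating-mono D′⊆R-z domD′))
      where
      D′⊆R-z : D′ ⊆ R - z
      D′⊆R-z y∈D′ = x∈p∧x≢y⇒x∈p-y (D′⊆R y∈D′) (λ { refl → z∉D′ y∈D′ })

  Pruned : Subset n → Subset n → List (Fin n) → Set
  Pruned A D ys = ∃[ R ] (R ⊆ D × A ⊆ R × Dominating G R ×
                          (∀ z → z ∈ˡ ys → z ∈ R → z ∉ A → ¬ Dominating G (R - z)))

  prune : ∀ {A} D ys → A ⊆ D → Dominating G D → Pruned A D ys
  prune D [] A⊆D dom = D , (λ z∈ → z∈) , A⊆D , dom , λ _ ()
  prune {A} D (y ∷ ys) A⊆D dom with y ∈? A | dominating? (D - y)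
  ... | no y∉A | yes dom-y =
    let R , R⊆ , A⊆R , domR , stuck = prune (D - y) ys A⊆D-y dom-y
    in R , (λ z∈R → p─q⊆p D ⁅ y ⁆ (R⊆ z∈R)) , A⊆R , domR ,
       λ { z (here refl) z∈R _ → ⊥-elim (x∉p-x D y (R⊆ z∈R)) ; z (there z∈ys) → stuck z z∈ys }
    where
    A⊆D-y : A ⊆ D - y
    A⊆D-y z∈A = x∈p∧x≢y⇒x∈p-y (A⊆D z∈A) (λ { refl → y∉A z∈A })
  ... | no y∉A | no ¬dom-y =
    let R , R⊆ , A⊆R , domR , stuck = prune D ys A⊆D dom
    in R , R⊆ , A⊆R , domR ,
       λ { z (here refl) _ _ domR-y → ¬dom-y (dominating-mono (-mono R⊆) domR-y)
         ; z (there z∈ys) → stuck z z∈ys }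
  ... | yes y∈A | _ =
    let R , R⊆ , A⊆R , domR , stuck = prune D ys A⊆D dom
    in R , R⊆ , A⊆R , domR ,
       λ { z (here refl) _ z∉A → ⊥-elim (z∉A y∈A) ; z (there z∈ys) → stuck z z∈ys }

module Characterisation {n : ℕ} (G : Graph n) (p7free : P7Free G) (chordal : Chordal G)
                        (I : Subset n) (irChoice : IRChoice G I) where
  open Neighbourhood G
  open ChordlessChains G chordal
  open Domination G

  I-minimal : ∀ {x} → x ∈ I → MinimalNbhd G x
  I-minimal = proj₁ irChoice _

  I-N-trans : ∀ {a b c} → a ∈ I → b ∈ I → c ∈ I → b ∈ N a → c ∈ N b → c ∈ N a
  I-N-trans a∈I b∈I c∈I = minimal-N-trans p7free (I-minimal a∈I) (I-minimal b∈I) (I-minimal c∈I)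

  irredundantBelow : ∀ u → ∃[ w ] (w ∈ I × N w ⊆ N u)
  irredundantBelow u =
    let x , mx , Nx⊆Nu = minimalBelow u
        w , w∈I , Nw≡Nx = proj₁ (proj₂ irChoice) x mx
    in w , w∈I , (λ v∈Nw → Nx⊆Nu (subst (_ ∈_) Nw≡Nx v∈Nw))

  walk-stays : ∀ {w p v} → w ∈ I → p ∈ I → p ∈ N w → Star (EdgeIn G I) p v → v ∈ N w
  walk-stays w∈I p∈I p∈Nw ε = p∈Nw
  walk-stays w∈I p∈I p∈Nw ((_ , q∈I , pq) ◅ walk) =
    walk-stays w∈I q∈I (I-N-trans w∈I p∈I q∈I p∈Nw (~⇒∈N pq)) walk

  nbhdComponent : ∀ {w} → w ∈ I → IrrComponent G I (N w ∩ I)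
  nbhdComponent {w} w∈I = w , w∈I , x∈p∩q⁺ (N-refl w , w∈I) , λ v → reach , collect
    where
    reach : ∀ {v} → v ∈ N w ∩ I → v ∈ I × Star (EdgeIn G I) w v
    reach v∈ with x∈p∩q⁻ _ _ v∈
    ... | v∈Nw , v∈I = v∈I , [ (λ { refl → ε }) , (λ wv → (w∈I , v∈I , wv) ◅ ε) ]′ (∈N⁻ v∈Nw)
    collect : ∀ {v} → v ∈ I → Star (EdgeIn G I) w v → v ∈ N w ∩ I
    collect v∈I walk = x∈p∩q⁺ (walk-stays w∈I w∈I (N-refl w) walk , v∈I)

  component-closed : ∀ {C u y} → IrrComponent G I C → u ∈ C → y ∈ I → y ∈ N u → y ∈ C
  component-closed (c , _ , _ , spec) u∈C y∈I y∈Nu with proj₁ (spec _) u∈C | ∈N⁻ y∈Nu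
  ... | _   , _    | inj₁ refl = u∈C
  ... | u∈I , walk | inj₂ uy   = proj₂ (spec _) y∈I (walk ◅◅ ((u∈I , y∈I , uy) ◅ ε))

  irredundantPrivate : ∀ {D x} → MinimalDominating G D → x ∈ D →
                       ∃[ w ] (w ∈ I × PrivateTo D x w × x ∈ N w)
  irredundantPrivate {D} minD@(dom , _) x∈D =
    let u , u-private = privateVertex minD x∈D
        w , w∈I , Nw⊆Nu = irredundantBelow u
        w-private : PrivateTo D _ w
        w-private y y∈D w∈Ny = u-private y y∈D (N-sym (Nw⊆Nu (N-sym w∈Ny)))
        y , y∈D , w∈Ny = dom w
    in w , w∈I , w-private , subst (_∈ N w) (w-private y y∈D w∈Ny) (N-sym w∈Ny)

  -- The component of such a w is dominated by D ∖ I: an irredundant dominator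
  -- of it would lie in N[w] and thus coincide with x ∉ I.
  componentDominated : ∀ {D x w} → Dominating G D → x ∉ I → w ∈ I → PrivateTo D x w →
                       ∀ v → v ∈ N w ∩ I → InOpenNbhd G (D ∩ ∁ I) v
  componentDominated {D} {w = w} dom x∉I w∈I w-private v v∈ =
    let v∈Nw , v∈I = x∈p∩q⁻ _ _ v∈
        y , y∈D , v∈Ny = dom v
    in (λ v∈D∖I → x∈∁p⇒x∉p (proj₂ (x∈p∩q⁻ D _ v∈D∖I)) v∈I) , y , outsideI v∈Nw v∈I y∈D v∈Ny , v∈Ny
    where
    outsideI : ∀ {v y} → v ∈ N w → v ∈ I → y ∈ D → v ∈ N y → y ∈ D ∩ ∁ I
    outsideI {y = y} v∈Nw v∈I y∈D v∈Ny with y ∈? I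
    ... | no  y∉I = x∈p∩q⁺ (y∈D , x∉p⇒x∈∁p y∉I)
    ... | yes y∈I = ⊥-elim (x∉I (subst (_∈ I) (w-private _ y∈D (N-sym y∈Nw)) y∈I))
      where
      y∈Nw = I-N-trans w∈I v∈I y∈I v∈Nw (N-sym v∈Ny)

  necessary : ∀ {A} → InDRN G I A → A ⊆ ∁ I × GoodSet G I A
  necessary (D , minD@(dom , _) , refl) = (λ x∈A → proj₂ (x∈p∩q⁻ D _ x∈A)) , good
    where
    good : GoodSet G I (D ∩ ∁ I)
    good x x∈A =
      let x∈D , x∈∁I = x∈p∩q⁻ D _ x∈A
          w , w∈I , w-private , x∈Nw = irredundantPrivate minD x∈D
      in w , N w ∩ I , w∈I , privateVertex⇒PrivateNbr (p∩q⊆p D _) w-private x∈Nw x∈A ,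
         nbhdComponent w∈I , x∈p∩q⁺ (N-refl w , w∈I) ,
         componentDominated dom (x∈∁p⇒x∉p x∈∁I) w∈I w-private

  undominated? : ∀ A v → Dec (v ∈ I × ¬ Dominates A v)
  undominated? A v = (v ∈? I) ×-dec ¬? (dominates? A v)

  undominated : Subset n → Subset n
  undominated A = subsetOf (undominated? A)

  undominated⁻ : ∀ {A v} → v ∈ undominated A → v ∈ I × ¬ Dominates A v
  undominated⁻ {A} = ∈-subsetOf⁻ (undominated? A)

  -- A together with the irredundant vertices it misses dominates G:
  -- a vertex v not dominated by A dominates an irredundant w below it.
  completion-dominating : ∀ A → Dominating G (A ∪ undominated A)
  completion-dominating A v with dominates? A v
  ... | yes (a , a∈A , v∈Na) = a , x∈p∪q⁺ (inj₁ a∈A) , v∈Na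
  ... | no  ¬domA =
    let w , w∈I , Nw⊆Nv = irredundantBelow v
        w-missed : ¬ Dominates A w
        w-missed (a , a∈A , w∈Na) = ¬domA (a , a∈A , N-sym (Nw⊆Nv (N-sym w∈Na)))
    in w , x∈p∪q⁺ (inj₂ (∈-subsetOf⁺ (undominated? A) (w∈I , w-missed))) ,
       N-sym (Nw⊆Nv (N-refl w))

  -- In a dominating R ⊆ A ∪ undominated A, no vertex of a good set A can be
  -- removed: its private neighbour u could only be dominated by an irredundant
  -- vertex of u's component, which is dominated by A and so not in R.
  good-irremovable : ∀ {A R z} → GoodSet G I A → R ⊆ A ∪ undominated A → z ∈ A →
                     ¬ Dominating G (R - z)
  good-irremovable {A} {z = z} good R⊆ z∈A dom =
    let u , C , u∈I , u-private , component , u∈C , C⊆N[A] = good z z∈A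
        y , y∈R-z , u∈Ny = dom u
        y∈R , y≢z = x∈p-y⁻ y∈R-z
        dominator-in-A : y ∈ A → ⊥
        dominator-in-A y∈A = y≢z (x∈⁅y⁆⇒x≡y z (subst (y ∈_) u-private (x∈p∩q⁺ (N-sym u∈Ny , y∈A))))
        dominator-missed : y ∈ undominated A → ⊥
        dominator-missed y∈U =
          let y∈I , y-missed = undominated⁻ y∈U
          in y-missed (proj₂ (C⊆N[A] y (component-closed component u∈C y∈I (N-sym u∈Ny))))
    in [ dominator-in-A , dominator-missed ]′ (x∈p∪q⁻ A _ (R⊆ y∈R))

  trace : ∀ {A R} → A ⊆ ∁ I → R ⊆ A ∪ undominated A → A ⊆ R → R ∩ ∁ I ≡ A
  trace {A} {R} A⊆∁I R⊆ A⊆R = ⊆-antisym ⊆A (λ z∈A → x∈p∩q⁺ (A⊆R z∈A , A⊆∁I z∈A))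
    where
    ⊆A : R ∩ ∁ I ⊆ A
    ⊆A z∈ with x∈p∩q⁻ R _ z∈
    ... | z∈R , z∈∁I with x∈p∪q⁻ A _ (R⊆ z∈R)
    ...   | inj₁ z∈A = z∈A
    ...   | inj₂ z∈U = ⊥-elim (x∈∁p⇒x∉p z∈∁I (proj₁ (undominated⁻ z∈U)))

  sufficient : ∀ {A} → A ⊆ ∁ I → GoodSet G I A → InDRN G I A
  sufficient {A} A⊆∁I good =
    minimalise (prune (A ∪ undominated A) (allFin n) (λ z∈A → x∈p∪q⁺ (inj₁ z∈A)) (completion-dominating A))
    where
    minimalise : Pruned A (A ∪ undominated A) (allFin n) → InDRN G I A
    minimalise (R , R⊆ , A⊆R , domR , stuck) = R , irremovable⇒minimal domR irremovable , trace A⊆∁I R⊆ A⊆R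
      where
      irremovable : ∀ z → z ∈ R → ¬ Dominating G (R - z)
      irremovable z z∈R with z ∈? A
      ... | yes z∈A = good-irremovable good R⊆ z∈A
      ... | no  z∉A = stuck z (∈-allFin z) z∈R z∉A

corollary11 : ∀ {n : ℕ} (G : Graph n) → P7Free G → Chordal G →
    (I : Subset n) → IRChoice G I → (A : Subset n) →
    InDRN G I A ⇔ (A ⊆ ∁ I × GoodSet G I A)
corollary11 G p7free chordal I irChoice A = mk⇔ necessary (uncurry sufficient)
  where open Characterisation G p7free chordal I irChoice
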